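{- Let $G$ be a finite simple graph. If $G$ has two distinct min-max clique coverings that both satisfy simple intersection, then $G$ contains $\mathrm{circ}(6,\{1,2\})$ as an induced subgraph.
   Context: A clique is a set of vertices inducing a complete subgraph; it is maximal if no vertex can be added to it keeping it a clique. A clique covering of $G$ is a set of cliques such that every edge of $G$ lies inside at least one of them; $\mathrm{cc}(G)$ denotes the minimum size of a clique covering. A min-max clique covering is a clique covering of size $\mathrm{cc}(G)$ in which every clique is maximal. A clique covering $\{C_1,\dots,C_\ell\}$ satisfies simple intersection if $C_i\cap C_j\cap C_k=\emptyset$ for all distinct $i,j,k$ (i.e. no vertex lies in three of the cliques). $\mathrm{circ}(6,\{1,2\})$ is the graph on $\{0,1,\dots,5\}$ in which $i$ and $j$ are adjacent iff $i-j\equiv \pm1$ or $\pm 2 \pmod 6$ (equivalently, the graph on the $2$-subsets of $\{1,2,3,4\}$ with two subsets adjacent iff they intersect). -}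

module Defs where

open import Data.Nat using (ℕ; _≤_; _%_; _+_; _∸_)
open import Data.Fin using (Fin; toℕ)
open import Data.Fin.Subset using (Subset; _∈_; _∉_; _∪_; ⁅_⁆)
open import Data.List using (List; length; lookup)
open import Data.List.Relation.Unary.Unique.Propositional using (Unique)
import Data.List.Membership.Propositional as LMem
open import Data.Product using (Σ; ∃; _×_)
open import Data.Sum using (_⊎_)
open import Data.Empty using (⊥)
open import Relation.Nullary using (¬_; Dec)
open import Relation.Binary.PropositionalEquality using (_≡_; _≢_)
open import Function.Bundles using (_⇔_)
open import Function.Definitions using (Injective)

record Graph (n : ℕ) : Set₁ where
  field
    Adj    : Fin n → Fin n → Set
    dec    : ∀ u v → Dec (Adj u v)
    sym    : ∀ {u v} → Adj u v → Adj v u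
    irrefl : ∀ {u} → ¬ Adj u u
open Graph public

module _ {n : ℕ} (G : Graph n) where

  IsClique : Subset n → Set
  IsClique C = ∀ u v → u ∈ C → v ∈ C → u ≢ v → Adj G u v

  IsMaximalClique : Subset n → Set
  IsMaximalClique C = IsClique C × (∀ w → w ∉ C → ¬ IsClique (⁅ w ⁆ ∪ C))

  IsCliqueCovering : List (Subset n) → Set
  IsCliqueCovering Cs =
    Unique Cs
    × (∀ C → C LMem.∈ Cs → IsClique C)
    × (∀ u v → Adj G u v → ∃ λ C → C LMem.∈ Cs × u ∈ C × v ∈ C)

  IsMinCliqueCovering : List (Subset n) → Set
  IsMinCliqueCovering Cs =
    IsCliqueCovering Cs × (∀ Ds → IsCliqueCovering Ds → length Cs ≤ length Ds)

  IsMinMaxCliqueCovering : List (Subset n) → Set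
  IsMinMaxCliqueCovering Cs =
    IsMinCliqueCovering Cs × (∀ C → C LMem.∈ Cs → IsMaximalClique C)

  SimpleIntersection : List (Subset n) → Set
  SimpleIntersection Cs =
    ∀ (v : Fin n) (i j k : Fin (length Cs)) → i ≢ j → j ≢ k → i ≢ k →
      v ∈ lookup Cs i → v ∈ lookup Cs j → v ∈ lookup Cs k → ⊥

SameSet : {n : ℕ} → List (Subset n) → List (Subset n) → Set
SameSet Cs Ds = ∀ C → (C LMem.∈ Cs) ⇔ (C LMem.∈ Ds)

-- adjacency of circ(6,{1,2}): i - j ≡ ±1 or ±2 (mod 6)
Circ612Adj : Fin 6 → Fin 6 → Set
Circ612Adj i j = d ≡ 1 ⊎ d ≡ 2 ⊎ d ≡ 4 ⊎ d ≡ 5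
  where d = (toℕ i + 6 ∸ toℕ j) % 6

HasInducedCirc612 : {n : ℕ} → Graph n → Set
HasInducedCirc612 {n} G =
  Σ (Fin 6 → Fin n) λ f → Injective _≡_ _≡_ f ×
    (∀ i j → Adj G (f i) (f j) ⇔ Circ612Adj i j)

-- Take a clique C of one covering that is not in the other, Ds. By minimality C has an edge,
-- and since every vertex lies in at most two cliques of Ds, none of which contains C, one
-- finds three distinct cliques D₁, D₂, D₃ of Ds meeting pairwise inside C. Each Dₖ leaves C
-- at some xₖ, which by maximality of C misses some yₖ ∈ C; simple intersection of Ds forces
-- yₖ into the other two Dₗ, and simple intersection of the first covering makes the xₖ, which
-- have common neighbours in C, pairwise adjacent. The six vertices xₖ, yₖ span an octahedron
-- K₂,₂,₂ = circ(6,{1,2}) whose non-edges are the pairs {xₖ, yₖ}.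
module Submission where

open import Defs
open import Data.Nat using (ℕ; _*_; _+_; _∸_; _%_; _≟_)
open import Data.Nat.Properties using (<⇒≱)
open import Data.Fin using (Fin; toℕ; quotient; remainder; remQuot; combine) renaming (_≟_ to _≟ᶠ_)
open import Data.Fin.Patterns using (0F; 1F; 2F)
open import Data.Fin.Properties using (any?; all?; combine-remQuot)
open import Data.Fin.Subset using (Subset; _∈_; _∉_; _⊆_; _∪_; ⁅_⁆)
open import Data.Fin.Subset.Properties using (_∈?_; x∈p∪q⁻; x∈⁅y⁆⇒x≡y; ⊆-antisym)
open import Data.Bool using () renaming (_≟_ to _≟ᵇ_)
open import Data.Vec.Properties using (≡-dec)
open import Data.List using (List; lookup; filter)
open import Data.List.Properties using (filter-notAll)
open import Data.List.Relation.Unary.Any as Any using (index)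
open import Data.List.Relation.Unary.Any.Properties using (lookup-index)
import Data.List.Relation.Unary.All as All
open import Data.List.Relation.Unary.All.Properties using (¬All⇒Any¬)
open import Data.List.Membership.Propositional using (find) renaming (_∈_ to _∈ₗ_; _∉_ to _∉ₗ_)
open import Data.List.Membership.Propositional.Properties using (∈-filter⁺; ∈-filter⁻)
open import Data.List.Relation.Unary.Unique.Propositional.Properties using (filter⁺)
open import Data.Product using (∃; ∃₂; _×_; _,_; proj₁; proj₂; uncurry)
open import Data.Sum using (_⊎_; inj₁; inj₂)
open import Data.Unit using (tt)
open import Function using (_∘_)
open import Function.Bundles using (_⇔_; mk⇔; Equivalence)
open import Function.Definitions using (Injective)
open import Relation.Nullary using (¬_; Dec; yes; no; ¬?; contradiction)
open import Relation.Nullary.Decidable using (toWitness; decidable-stable; _×-dec_; _⊎-dec_; _→-dec_)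
open import Relation.Unary using (Pred; Decidable)
open import Relation.Binary.Definitions using (DecidableEquality)
open import Relation.Binary.PropositionalEquality
  using (_≡_; _≢_; refl; trans; cong; cong₂; subst; ≢-sym; module ≡-Reasoning)
  renaming (sym to ≡-sym)

_≟ˢ_ : ∀ {n} → DecidableEquality (Subset n)
_≟ˢ_ = ≡-dec _≟ᵇ_

_∈ₗ?_ : ∀ {n} (C : Subset n) (Cs : List (Subset n)) → Dec (C ∈ₗ Cs)
C ∈ₗ? Cs = Any.any? (C ≟ˢ_) Cs

∈∧∉⇒≢ : ∀ {n} {A : Subset n} {x y} → x ∈ A → y ∉ A → x ≢ y
∈∧∉⇒≢ x∈A y∉A refl = y∉A x∈A

∉∧∈⇒≢ : ∀ {n} {A : Subset n} {x y} → x ∉ A → y ∈ A → x ≢ y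
∉∧∈⇒≢ x∉A y∈A = ≢-sym (∈∧∉⇒≢ y∈A x∉A)

¬∀∈⇒∃∈¬ : ∀ {n p} {P : Pred (Fin n) p} (A : Subset n) → Decidable P →
          ¬ (∀ {x} → x ∈ A → P x) → ∃ λ x → x ∈ A × ¬ P x
¬∀∈⇒∃∈¬ A P? ¬∀ = decidable-stable (any? λ x → (x ∈? A) ×-dec ¬? (P? x)) λ ∄ →
  ¬∀ λ {x} x∈A → decidable-stable (P? x) λ ¬Px → ∄ (x , x∈A , ¬Px)

¬SameSet⇒∃∈∉ : ∀ {n} {Cs Ds : List (Subset n)} → ¬ SameSet Cs Ds →
               (∃ λ C → C ∈ₗ Cs × C ∉ₗ Ds) ⊎ (∃ λ C → C ∈ₗ Ds × C ∉ₗ Cs)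
¬SameSet⇒∃∈∉ {Cs = Cs} {Ds} Cs≉Ds with All.all? (_∈ₗ? Ds) Cs | All.all? (_∈ₗ? Cs) Ds
... | yes Cs⊆Ds | yes Ds⊆Cs = contradiction (λ C → mk⇔ (All.lookup Cs⊆Ds) (All.lookup Ds⊆Cs)) Cs≉Ds
... | no Cs⊈Ds  | _         = inj₁ (find (¬All⇒Any¬ (_∈ₗ? Ds) Cs Cs⊈Ds))
... | _         | no Ds⊈Cs  = inj₂ (find (¬All⇒Any¬ (_∈ₗ? Cs) Ds Ds⊈Cs))

remQuot-injective : ∀ {m} k {i j : Fin (m * k)} → remQuot {m} k i ≡ remQuot k j → i ≡ j
remQuot-injective {m} k {i} {j} eq = begin
  i                                  ≡⟨ ≡-sym (combine-remQuot {m} k i) ⟩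
  uncurry combine (remQuot {m} k i)  ≡⟨ cong (uncurry combine) eq ⟩
  uncurry combine (remQuot {m} k j)  ≡⟨ combine-remQuot {m} k j ⟩
  j                                  ∎
  where open ≡-Reasoning

part : Fin 6 → Fin 3
part = remainder {2} 3

slot : Fin 6 → Fin 2
slot = quotient {2} 3

circ612Adj? : ∀ i j → Dec (Circ612Adj i j)
circ612Adj? i j = (d ≟ 1) ⊎-dec (d ≟ 2) ⊎-dec (d ≟ 4) ⊎-dec (d ≟ 5)
  where d = (toℕ i + 6 ∸ toℕ j) % 6

-- circ(6,{1,2}) is the octahedron K₂,₂,₂ whose parts are the classes of Fin 6 modulo 3.
circ612Adj⇔part≢ : ∀ i j → Circ612Adj i j ⇔ (part i ≢ part j)
circ612Adj⇔part≢ i j = mk⇔ (proj₁ (table i j)) (proj₂ (table i j))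
  where
    table = toWitness {a? = all? λ i → all? λ j →
      (circ612Adj? i j →-dec ¬? (part i ≟ᶠ part j)) ×-dec
      (¬? (part i ≟ᶠ part j) →-dec circ612Adj? i j)} tt

avoid-two : ∀ (k l : Fin 3) → ∃ λ m → m ≢ k × m ≢ l
avoid-two = toWitness {a? = all? λ k → all? λ l → any? λ m → ¬? (m ≟ᶠ k) ×-dec ¬? (m ≟ᶠ l)} tt

module _ {n : ℕ} (G : Graph n) where

  induced-octahedron : (v : Fin 3 → Fin 2 → Fin n) →
    (∀ {k l} s t → k ≢ l → Adj G (v k s) (v l t)) →
    (∀ k → v k 0F ≢ v k 1F) →
    (∀ k → ¬ Adj G (v k 0F) (v k 1F)) →
    HasInducedCirc612 G
  induced-octahedron v cross distinct nonadjacent = f , f-injective , λ i j → mk⇔ (to i j) (from i j)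
    where
      f : Fin 6 → Fin n
      f i = v (part i) (slot i)

      same-part-injective : ∀ {k l} s t → k ≡ l → v k s ≡ v l t → s ≡ t
      same-part-injective 0F 0F refl _  = refl
      same-part-injective 0F 1F refl eq = contradiction eq (distinct _)
      same-part-injective 1F 0F refl eq = contradiction (≡-sym eq) (distinct _)
      same-part-injective 1F 1F refl _  = refl

      same-part-independent : ∀ {k l} s t → k ≡ l → ¬ Adj G (v k s) (v l t)
      same-part-independent 0F 0F refl = irrefl G
      same-part-independent 0F 1F refl = nonadjacent _
      same-part-independent 1F 0F refl = nonadjacent _ ∘ sym G
      same-part-independent 1F 1F refl = irrefl G

      to : ∀ i j → Adj G (f i) (f j) → Circ612Adj i j
      to i j fi~fj = Equivalence.from (circ612Adj⇔part≢ i j)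
        λ eq → same-part-independent (slot i) (slot j) eq fi~fj

      from : ∀ i j → Circ612Adj i j → Adj G (f i) (f j)
      from i j c = cross _ _ (Equivalence.to (circ612Adj⇔part≢ i j) c)

      f-injective : Injective _≡_ _≡_ f
      f-injective {i} {j} fi≡fj with part i ≟ᶠ part j
      ... | no parts≢ = contradiction (subst (Adj G (f i)) (≡-sym fi≡fj) (cross _ _ parts≢)) (irrefl G)
      ... | yes parts≡ = remQuot-injective {2} 3
        (cong₂ _,_ (same-part-injective (slot i) (slot j) parts≡ fi≡fj) parts≡)

  clique-⁅⁆∪ : ∀ {C x} → IsClique G C → (∀ {c} → c ∈ C → Adj G x c) → IsClique G (⁅ x ⁆ ∪ C)
  clique-⁅⁆∪ {C} {x} C-clique x~C u v u∈ v∈ u≢v with x∈p∪q⁻ ⁅ x ⁆ C u∈ | x∈p∪q⁻ ⁅ x ⁆ C v∈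
  ... | inj₁ u∈x | inj₁ v∈x = contradiction (trans (x∈⁅y⁆⇒x≡y x u∈x) (≡-sym (x∈⁅y⁆⇒x≡y x v∈x))) u≢v
  ... | inj₁ u∈x | inj₂ v∈C with refl ← x∈⁅y⁆⇒x≡y x u∈x = x~C v∈C
  ... | inj₂ u∈C | inj₁ v∈x with refl ← x∈⁅y⁆⇒x≡y x v∈x = sym G (x~C u∈C)
  ... | inj₂ u∈C | inj₂ v∈C = C-clique u v u∈C v∈C u≢v

  maximal⇒nonNeighbour : ∀ {C x} → IsMaximalClique G C → x ∉ C → ∃ λ c → c ∈ C × ¬ Adj G x c
  maximal⇒nonNeighbour {C} {x} (C-clique , C-maximal) x∉C =
    ¬∀∈⇒∃∈¬ C (dec G x) λ x~C → C-maximal x x∉C (clique-⁅⁆∪ C-clique x~C)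

  maximal-⊆⇒≡ : ∀ {C D} → IsMaximalClique G C → IsClique G D → C ⊆ D → C ≡ D
  maximal-⊆⇒≡ {C} {D} C-maximal D-clique C⊆D = ⊆-antisym C⊆D D⊆C
    where
      D⊆C : D ⊆ C
      D⊆C {y} y∈D = decidable-stable (y ∈? C) λ y∉C →
        let c , c∈C , y≁c = maximal⇒nonNeighbour C-maximal y∉C
        in y≁c (D-clique y c y∈D (C⊆D c∈C) (∉∧∈⇒≢ y∉C c∈C))

  maximal-≢⇒∃∈∉ : ∀ {C D} → IsMaximalClique G C → IsClique G D → C ≢ D → ∃ λ x → x ∈ C × x ∉ D
  maximal-≢⇒∃∈∉ {C} {D} C-maximal D-clique C≢D =
    ¬∀∈⇒∃∈¬ C (_∈? D) λ C⊆D → C≢D (maximal-⊆⇒≡ C-maximal D-clique C⊆D)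

  -- A clique with at most one vertex covers no edge.
  covering-without-trivial : ∀ {Cs C} → IsCliqueCovering G Cs → (∀ {u v} → u ∈ C → v ∈ C → u ≡ v) →
                             IsCliqueCovering G (filter (¬? ∘ (_≟ˢ C)) Cs)
  covering-without-trivial {Cs} {C} (unique , cliques , covers) C-trivial =
    filter⁺ (¬? ∘ (_≟ˢ C)) unique , (λ D D∈ → cliques D (proj₁ (∈-filter⁻ (¬? ∘ (_≟ˢ C)) D∈))) , covers′
    where
      covers′ : ∀ u v → Adj G u v → ∃ λ D → D ∈ₗ filter (¬? ∘ (_≟ˢ C)) Cs × u ∈ D × v ∈ D
      covers′ u v u~v with covers u v u~v
      ... | D , D∈Cs , u∈D , v∈D with D ≟ˢ C
      ...   | yes refl = contradiction (subst (Adj G u) (≡-sym (C-trivial u∈D v∈D)) u~v) (irrefl G)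
      ...   | no D≢C = D , ∈-filter⁺ (¬? ∘ (_≟ˢ C)) D∈Cs D≢C , u∈D , v∈D

  min-covering-clique-nontrivial : ∀ {Cs C} → IsMinCliqueCovering G Cs → C ∈ₗ Cs →
                                   ∃₂ λ u v → u ∈ C × v ∈ C × u ≢ v
  min-covering-clique-nontrivial {Cs} {C} (covering , minimum) C∈Cs =
    decidable-stable (any? λ u → any? λ v → (u ∈? C) ×-dec (v ∈? C) ×-dec ¬? (u ≟ᶠ v)) λ ∄ →
      <⇒≱ (filter-notAll (¬? ∘ (_≟ˢ C)) Cs (Any.map (λ { refl C≢C → C≢C refl }) C∈Cs))
          (minimum _ (covering-without-trivial covering λ {u} {v} u∈C v∈C →
            decidable-stable (u ≟ᶠ v) λ u≢v → ∄ (u , v , u∈C , v∈C , u≢v)))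

  module SimpleCovering {Cs : List (Subset n)}
    (covering : IsCliqueCovering G Cs) (simple : SimpleIntersection G Cs) where

    private
      index-injective : ∀ {X Y} (X∈ : X ∈ₗ Cs) (Y∈ : Y ∈ₗ Cs) → index X∈ ≡ index Y∈ → X ≡ Y
      index-injective X∈ Y∈ eq =
        trans (lookup-index X∈) (trans (cong (lookup Cs) eq) (≡-sym (lookup-index Y∈)))

      ∈-lookup : ∀ {X v} (X∈ : X ∈ₗ Cs) → v ∈ X → v ∈ lookup Cs (index X∈)
      ∈-lookup X∈ = subst (_ ∈_) (lookup-index X∈)

    at-most-two-cliques : ∀ {P Q R v} → P ∈ₗ Cs → Q ∈ₗ Cs → R ∈ₗ Cs → P ≢ Q → R ≢ P →
                          v ∈ P → v ∈ Q → v ∈ R → R ≡ Q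
    at-most-two-cliques {v = v} P∈ Q∈ R∈ P≢Q R≢P v∈P v∈Q v∈R = decidable-stable (_ ≟ˢ _) λ R≢Q →
      simple v (index P∈) (index Q∈) (index R∈)
        (P≢Q ∘ index-injective P∈ Q∈) (≢-sym R≢Q ∘ index-injective Q∈ R∈)
        (≢-sym R≢P ∘ index-injective P∈ R∈)
        (∈-lookup P∈ v∈P) (∈-lookup Q∈ v∈Q) (∈-lookup R∈ v∈R)

    neighbour-∈-other : ∀ {P Q v w} → P ∈ₗ Cs → Q ∈ₗ Cs → P ≢ Q → v ∈ P → v ∈ Q →
                        Adj G v w → w ∉ P → w ∈ Q
    neighbour-∈-other P∈ Q∈ P≢Q v∈P v∈Q v~w w∉P =
      let E , E∈ , v∈E , w∈E = proj₂ (proj₂ covering) _ _ v~w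
      in subst (_ ∈_) (at-most-two-cliques P∈ Q∈ E∈ P≢Q (λ { refl → w∉P w∈E }) v∈P v∈Q v∈E) w∈E

    common-neighbour⇒adjacent : ∀ {C y s t} → C ∈ₗ Cs → y ∈ C → s ∉ C → t ∉ C →
                                Adj G y s → Adj G y t → s ≢ t → Adj G s t
    common-neighbour⇒adjacent C∈ y∈C s∉C t∉C y~s y~t s≢t =
      let E , E∈ , y∈E , s∈E = proj₂ (proj₂ covering) _ _ y~s
          t∈E = neighbour-∈-other C∈ E∈ (λ { refl → s∉C s∈E }) y∈C y∈E y~t t∉C
      in proj₁ (proj₂ covering) E E∈ _ _ s∈E t∈E s≢t

module UnsharedClique {n : ℕ} (G : Graph n) {Cs Ds : List (Subset n)}
  (Cs-minmax : IsMinMaxCliqueCovering G Cs) (Cs-simple : SimpleIntersection G Cs)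
  (Ds-minmax : IsMinMaxCliqueCovering G Ds) (Ds-simple : SimpleIntersection G Ds)
  {C : Subset n} (C∈Cs : C ∈ₗ Cs) (C∉Ds : C ∉ₗ Ds) where

  open SimpleCovering G (proj₁ (proj₁ Cs-minmax)) Cs-simple using (common-neighbour⇒adjacent)
  open SimpleCovering G (proj₁ (proj₁ Ds-minmax)) Ds-simple using (at-most-two-cliques; neighbour-∈-other)

  private
    C-maximal : IsMaximalClique G C
    C-maximal = proj₂ Cs-minmax C C∈Cs

    C-clique : IsClique G C
    C-clique = proj₁ C-maximal

    Ds-clique : ∀ {D} → D ∈ₗ Ds → IsClique G D
    Ds-clique D∈ = proj₁ (proj₂ Ds-minmax _ D∈)

    Ds-cover : ∀ {u v} → u ∈ C → v ∈ C → u ≢ v → ∃ λ D → D ∈ₗ Ds × u ∈ D × v ∈ D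
    Ds-cover u∈C v∈C u≢v = proj₂ (proj₂ (proj₁ (proj₁ Ds-minmax))) _ _ (C-clique _ _ u∈C v∈C u≢v)

  C⊈ : ∀ {D} → D ∈ₗ Ds → ∃ λ x → x ∈ C × x ∉ D
  C⊈ D∈ = maximal-≢⇒∃∈∉ G C-maximal (Ds-clique D∈) λ { refl → C∉Ds D∈ }

  ⊈C : ∀ {D} → D ∈ₗ Ds → ∃ λ x → x ∈ D × x ∉ C
  ⊈C D∈ = maximal-≢⇒∃∈∉ G (proj₂ Ds-minmax _ D∈) C-clique λ { refl → C∉Ds D∈ }

  leave-into-other : ∀ {P Q u} → P ∈ₗ Ds → Q ∈ₗ Ds → P ≢ Q → u ∈ C → u ∈ P → u ∈ Q →
                     ∃ λ c → c ∈ C × c ∉ P × c ∈ Q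
  leave-into-other P∈ Q∈ P≢Q u∈C u∈P u∈Q =
    let c , c∈C , c∉P = C⊈ P∈
    in c , c∈C , c∉P , neighbour-∈-other P∈ Q∈ P≢Q u∈P u∈Q (C-clique _ _ u∈C c∈C (∈∧∉⇒≢ u∈P c∉P)) c∉P

  record Triangle : Set where
    field
      side     : Fin 3 → Subset n
      side∈Ds  : ∀ k → side k ∈ₗ Ds
      corner   : Fin 3 → Fin n
      corner∈C : ∀ k → corner k ∈ C
      corner∉  : ∀ k → corner k ∉ side k
      corner∈  : ∀ {k l} → k ≢ l → corner k ∈ side l

  triangle-from : ∀ {D₁ D₂ D₃ a b c} → D₁ ∈ₗ Ds → D₂ ∈ₗ Ds → D₃ ∈ₗ Ds →
    a ∈ C → a ∉ D₁ → a ∈ D₂ → a ∈ D₃ →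
    b ∈ C → b ∈ D₁ → b ∉ D₂ → b ∈ D₃ →
    c ∈ C → c ∈ D₁ → c ∈ D₂ → Triangle
  triangle-from {D₁} {D₂} {D₃} {a} {b} {c}
    D₁∈ D₂∈ D₃∈ a∈C a∉D₁ a∈D₂ a∈D₃ b∈C b∈D₁ b∉D₂ b∈D₃ c∈C c∈D₁ c∈D₂ =
    record { side = side ; side∈Ds = side∈Ds ; corner = corner
           ; corner∈C = corner∈C ; corner∉ = corner∉ ; corner∈ = corner∈ }
    where
      side : Fin 3 → Subset n
      side 0F = D₁
      side 1F = D₂
      side 2F = D₃

      side∈Ds : ∀ k → side k ∈ₗ Ds
      side∈Ds 0F = D₁∈
      side∈Ds 1F = D₂∈
      side∈Ds 2F = D₃∈

      corner : Fin 3 → Fin n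
      corner 0F = a
      corner 1F = b
      corner 2F = c

      corner∈C : ∀ k → corner k ∈ C
      corner∈C 0F = a∈C
      corner∈C 1F = b∈C
      corner∈C 2F = c∈C

      -- c ∈ D₁ ∩ D₂ rules out c ∈ D₃ by simple intersection.
      corner∉ : ∀ k → corner k ∉ side k
      corner∉ 0F = a∉D₁
      corner∉ 1F = b∉D₂
      corner∉ 2F c∈D₃ = b∉D₂ (subst (b ∈_) (at-most-two-cliques D₁∈ D₂∈ D₃∈
        (λ { refl → a∉D₁ a∈D₂ }) (λ { refl → a∉D₁ a∈D₃ }) c∈D₁ c∈D₂ c∈D₃) b∈D₃)

      corner∈ : ∀ {k l} → k ≢ l → corner k ∈ side l
      corner∈ {0F} {0F} k≢l = contradiction refl k≢l
      corner∈ {0F} {1F} _   = a∈D₂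
      corner∈ {0F} {2F} _   = a∈D₃
      corner∈ {1F} {0F} _   = b∈D₁
      corner∈ {1F} {1F} k≢l = contradiction refl k≢l
      corner∈ {1F} {2F} _   = b∈D₃
      corner∈ {2F} {0F} _   = c∈D₁
      corner∈ {2F} {1F} _   = c∈D₂
      corner∈ {2F} {2F} k≢l = contradiction refl k≢l

  triangle : Triangle
  triangle =
    let u , _ , u∈C , v∈C , u≢v = min-covering-clique-nontrivial G (proj₁ Cs-minmax) C∈Cs
        D₁ , D₁∈ , u∈D₁ , _ = Ds-cover u∈C v∈C u≢v
        c , c∈C , c∉D₁ = C⊈ D₁∈
        D₂ , D₂∈ , u∈D₂ , c∈D₂ = Ds-cover u∈C c∈C (∈∧∉⇒≢ u∈D₁ c∉D₁)
        D₂≢D₁ = λ eq → c∉D₁ (subst (c ∈_) eq c∈D₂)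
        b , b∈C , b∉D₂ , b∈D₁ = leave-into-other D₂∈ D₁∈ D₂≢D₁ u∈C u∈D₂ u∈D₁
        D₃ , D₃∈ , b∈D₃ , c∈D₃ = Ds-cover b∈C c∈C (∈∧∉⇒≢ b∈D₁ c∉D₁)
    in triangle-from D₁∈ D₂∈ D₃∈ c∈C c∉D₁ c∈D₂ c∈D₃ b∈C b∈D₁ b∉D₂ b∈D₃ u∈C u∈D₁ u∈D₂

  open Triangle triangle

  sides-distinct : ∀ {k l} → k ≢ l → side k ≢ side l
  sides-distinct k≢l eq = corner∉ _ (subst (corner _ ∈_) (≡-sym eq) (corner∈ k≢l))

  shared : ∀ k l → ∃ λ w → w ∈ C × w ∈ side k × w ∈ side l
  shared k l = let m , m≢k , m≢l = avoid-two k l in corner m , corner∈C m , corner∈ m≢k , corner∈ m≢l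

  outer : Fin 3 → Fin n
  outer k = proj₁ (⊈C (side∈Ds k))

  outer∈side : ∀ k → outer k ∈ side k
  outer∈side k = proj₁ (proj₂ (⊈C (side∈Ds k)))

  outer∉C : ∀ k → outer k ∉ C
  outer∉C k = proj₂ (proj₂ (⊈C (side∈Ds k)))

  inner : Fin 3 → Fin n
  inner k = proj₁ (maximal⇒nonNeighbour G C-maximal (outer∉C k))

  inner∈C : ∀ k → inner k ∈ C
  inner∈C k = proj₁ (proj₂ (maximal⇒nonNeighbour G C-maximal (outer∉C k)))

  outer≁inner : ∀ k → ¬ Adj G (outer k) (inner k)
  outer≁inner k = proj₂ (proj₂ (maximal⇒nonNeighbour G C-maximal (outer∉C k)))

  inner∉side : ∀ k → inner k ∉ side k
  inner∉side k y∈ =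
    outer≁inner k (Ds-clique (side∈Ds k) _ _ (outer∈side k) y∈ (∉∧∈⇒≢ (outer∉C k) (inner∈C k)))

  inner∈side : ∀ {k l} → k ≢ l → inner k ∈ side l
  inner∈side {k} {l} k≢l =
    let w , w∈C , w∈k , w∈l = shared k l
    in neighbour-∈-other (side∈Ds k) (side∈Ds l) (sides-distinct k≢l) w∈k w∈l
         (C-clique _ _ w∈C (inner∈C k) (∈∧∉⇒≢ w∈k (inner∉side k))) (inner∉side k)

  outer~inner : ∀ {k l} → k ≢ l → Adj G (outer k) (inner l)
  outer~inner {k} k≢l = Ds-clique (side∈Ds k) _ _ (outer∈side k) (inner∈side (≢-sym k≢l))
    (∉∧∈⇒≢ (outer∉C k) (inner∈C _))

  inner~inner : ∀ {k l} → k ≢ l → Adj G (inner k) (inner l)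
  inner~inner {k} k≢l =
    C-clique _ _ (inner∈C k) (inner∈C _) (∉∧∈⇒≢ (inner∉side k) (inner∈side (≢-sym k≢l)))

  outer~outer : ∀ {k l} → k ≢ l → Adj G (outer k) (outer l)
  outer~outer {k} {l} k≢l =
    let w , w∈C , w∈k , w∈l = shared k l
        w~outer : ∀ {m} → w ∈ side m → Adj G w (outer m)
        w~outer {m} w∈m = Ds-clique (side∈Ds m) _ _ w∈m (outer∈side m) (∈∧∉⇒≢ w∈C (outer∉C m))
    in common-neighbour⇒adjacent C∈Cs w∈C (outer∉C k) (outer∉C l) (w~outer w∈k) (w~outer w∈l)
         λ eq → outer≁inner l (subst (λ x → Adj G x (inner l)) eq (outer~inner k≢l))

  vertex : Fin 3 → Fin 2 → Fin n
  vertex k 0F = outer k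
  vertex k 1F = inner k

  cross : ∀ {k l} s t → k ≢ l → Adj G (vertex k s) (vertex l t)
  cross 0F 0F = outer~outer
  cross 0F 1F = outer~inner
  cross 1F 0F k≢l = sym G (outer~inner (≢-sym k≢l))
  cross 1F 1F = inner~inner

  induced-circ612 : HasInducedCirc612 G
  induced-circ612 = induced-octahedron G vertex cross
    (λ k → ∉∧∈⇒≢ (outer∉C k) (inner∈C k)) outer≁inner

theorem3p1 : (n : ℕ) (G : Graph n) (Cs Ds : List (Subset n)) →
    IsMinMaxCliqueCovering G Cs → SimpleIntersection G Cs →
    IsMinMaxCliqueCovering G Ds → SimpleIntersection G Ds →
    ¬ SameSet Cs Ds →
    HasInducedCirc612 G
theorem3p1 n G Cs Ds Cs-minmax Cs-simple Ds-minmax Ds-simple Cs≉Ds with ¬SameSet⇒∃∈∉ Cs≉Ds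
... | inj₁ (_ , C∈Cs , C∉Ds) =
  UnsharedClique.induced-circ612 G Cs-minmax Cs-simple Ds-minmax Ds-simple C∈Cs C∉Ds
... | inj₂ (_ , C∈Ds , C∉Cs) =
  UnsharedClique.induced-circ612 G Ds-minmax Ds-simple Cs-minmax Cs-simple C∈Ds C∉Cs
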